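{- If $Z$ is an $\mathsf{SR}$-bisimulation and $(\mathcal{M},s)\,Z\,(\mathcal{N},t)$, then for every $\mathsf{MLSR}$-formula $\varphi$: $\mathcal{M},s\models\varphi$ iff $\mathcal{N},t\models\varphi$.
   Context: $\mathsf{MLSR}$-formulas: $\varphi ::= p \mid \neg\varphi \mid (\varphi\vee\varphi)\mid \Diamond\varphi \mid \langle-\varphi\rangle\varphi$. Models are $\mathcal{M}=(W,R,V)$ with $R\subseteq W\times W$, $V$ a valuation; for $D\subseteq W$, $\mathcal{M}-D$ is the submodel with domain $W\setminus D$. Truth is standard for letters, Booleans and $\Diamond$, and $\mathcal{M},s\models\langle-\alpha\rangle\beta$ iff there is $t\neq s$ with $\mathcal{M},t\models\alpha$ and $\mathcal{M}-\{t\},s\models\beta$. An $\mathsf{SR}$-bisimulation is a relation $Z$ between pointed models such that whenever $(\mathcal{M},s)Z(\mathcal{N},t)$: $s,t$ satisfy the same proposition letters; if $R^{\mathcal{M}}ss'$ there is $t'$ with $R^{\mathcal{N}}tt'$ and $(\mathcal{M},s')Z(\mathcal{N},t')$, and conversely; for every $u\in\mathcal{M}$, $u\neq s$, there is $v\in\mathcal{N}$, $v\neq t$, with $(\mathcal{M},u)Z(\mathcal{N},v)$ and $(\mathcal{M}-\{u\},s)Z(\mathcal{N}-\{v\},t)$; and the analogous clause in the converse direction. -}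

module Defs where

open import Level using (Level; _⊔_) renaming (suc to lsuc; zero to lzero)
open import Data.Nat using (ℕ)
open import Data.Product using (Σ; ∃; _×_; _,_; proj₁; proj₂)
open import Data.Sum using (_⊎_)
open import Relation.Nullary using (¬_)
open import Relation.Binary.PropositionalEquality using (_≡_; _≢_; sym)
open import Function.Bundles using (_⇔_)

Atom : Set
Atom = ℕ

data Fm : Set where
  var  : Atom → Fm
  ¬'_  : Fm → Fm
  _∨'_ : Fm → Fm → Fm
  ◇_   : Fm → Fm
  ⟨-_⟩_ : Fm → Fm → Fm

record Model : Set₁ where
  field
    W : Set
    R : W → W → Set
    V : Atom → W → Set
open Model public

_-[_] : (M : Model) → W M → Model
W (M -[ u ]) = Σ (W M) (λ w → w ≢ u)
R (M -[ u ]) x y = R M (proj₁ x) (proj₁ y)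
V (M -[ u ]) p x = V M p (proj₁ x)

≢-sym : {A : Set} {a b : A} → a ≢ b → b ≢ a
≢-sym ne eq = ne (sym eq)

_,_⊨_ : (M : Model) → W M → Fm → Set
M , s ⊨ var p = V M p s
M , s ⊨ (¬' φ) = ¬ (M , s ⊨ φ)
M , s ⊨ (φ ∨' ψ) = (M , s ⊨ φ) ⊎ (M , s ⊨ ψ)
M , s ⊨ (◇ φ) = Σ (W M) (λ s' → R M s s' × (M , s' ⊨ φ))
M , s ⊨ (⟨- α ⟩ β) =
  Σ (W M) (λ t → Σ (t ≢ s) (λ t≢s →
    (M , t ⊨ α) × ((M -[ t ]) , (s , ≢-sym t≢s) ⊨ β)))

PModel : Set₁
PModel = Σ Model W

record IsSRBisim {ℓ : Level} (Z : PModel → PModel → Set ℓ) : Set (lsuc lzero ⊔ ℓ) where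
  field
    atoms : ∀ {M N s t} → Z (M , s) (N , t) → ∀ p → (V M p s → V N p t) × (V N p t → V M p s)
    forth : ∀ {M N s t} → Z (M , s) (N , t) → ∀ s' → R M s s' →
            Σ (W N) (λ t' → R N t t' × Z (M , s') (N , t'))
    back  : ∀ {M N s t} → Z (M , s) (N , t) → ∀ t' → R N t t' →
            Σ (W M) (λ s' → R M s s' × Z (M , s') (N , t'))
    forth-del : ∀ {M N s t} → Z (M , s) (N , t) → ∀ u → (u≢s : u ≢ s) →
            Σ (W N) (λ v → Σ (v ≢ t) (λ v≢t →
              Z (M , u) (N , v) ×
              Z ((M -[ u ]) , (s , ≢-sym u≢s)) ((N -[ v ]) , (t , ≢-sym v≢t))))
    back-del : ∀ {M N s t} → Z (M , s) (N , t) → ∀ v → (v≢t : v ≢ t) →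
            Σ (W M) (λ u → Σ (u ≢ s) (λ u≢s →
              Z (M , u) (N , v) ×
              Z ((M -[ u ]) , (s , ≢-sym u≢s)) ((N -[ v ]) , (t , ≢-sym v≢t))))

-- Induction on the formula, proving preservation and reflection together since
-- negation swaps the two directions. The deletion clauses of an SR-bisimulation
-- relate the submodels M - {u} and N - {v}, which is exactly where the induction
-- hypothesis for the second argument of ⟨- α ⟩ β is applied.
module Submission where

open import Defs
open import Level using (Level)
open import Data.Product using (_,_; proj₁; proj₂)
open import Data.Sum using () renaming (map to ⊎-map)
open import Function.Bundles using (_⇔_; mk⇔)

module _ {ℓ : Level} (Z : PModel → PModel → Set ℓ) (bisim : IsSRBisim Z) where
  open IsSRBisim bisim

  ⊨-preserved : ∀ φ {M N s t} → Z (M , s) (N , t) → M , s ⊨ φ → N , t ⊨ φ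
  ⊨-reflected : ∀ φ {M N s t} → Z (M , s) (N , t) → N , t ⊨ φ → M , s ⊨ φ

  ⊨-preserved (var p)    z = proj₁ (atoms z p)
  ⊨-preserved (¬' φ)     z ¬φs φt = ¬φs (⊨-reflected φ z φt)
  ⊨-preserved (φ ∨' ψ)   z = ⊎-map (⊨-preserved φ z) (⊨-preserved ψ z)
  ⊨-preserved (◇ φ)      z (s' , Rss' , φs') =
    let t' , Rtt' , z' = forth z s' Rss' in t' , Rtt' , ⊨-preserved φ z' φs'
  ⊨-preserved (⟨- α ⟩ β) z (u , u≢s , αu , β-u) =
    let v , v≢t , zuv , z-uv = forth-del z u u≢s
    in  v , v≢t , ⊨-preserved α zuv αu , ⊨-preserved β z-uv β-u

  ⊨-reflected (var p)    z = proj₂ (atoms z p)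
  ⊨-reflected (¬' φ)     z ¬φt φs = ¬φt (⊨-preserved φ z φs)
  ⊨-reflected (φ ∨' ψ)   z = ⊎-map (⊨-reflected φ z) (⊨-reflected ψ z)
  ⊨-reflected (◇ φ)      z (t' , Rtt' , φt') =
    let s' , Rss' , z' = back z t' Rtt' in s' , Rss' , ⊨-reflected φ z' φt'
  ⊨-reflected (⟨- α ⟩ β) z (v , v≢t , αv , β-v) =
    let u , u≢s , zuv , z-uv = back-del z v v≢t
    in  u , u≢s , ⊨-reflected α zuv αv , ⊨-reflected β z-uv β-v

mainTheorem2 : {ℓ : Level} (Z : PModel → PModel → Set ℓ) → IsSRBisim Z →
    (M N : Model) (s : W M) (t : W N) → Z (M , s) (N , t) →
    (φ : Fm) → (M , s ⊨ φ) ⇔ (N , t ⊨ φ)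
mainTheorem2 Z bisim M N s t z φ = mk⇔ (⊨-preserved Z bisim φ z) (⊨-reflected Z bisim φ z)
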